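{- Let $G$ and $H$ be nontrivial, connected graphs such that $G \times H$ is well-covered but not very well-covered. If $I$ is any independent set of $G$ and $B$ is any bipartite component of $G-N[I]$, then $B=K_1$.
   Context: Graphs are finite and simple; nontrivial means having at least two vertices. The direct product $G\times H$ has vertex set $V(G)\times V(H)$, with $(g_1,h_1)(g_2,h_2)$ an edge iff $g_1g_2\in E(G)$ and $h_1h_2\in E(H)$. A graph is well-covered if all of its maximal independent sets have the same cardinality; it is very well-covered if it is well-covered, has no isolated vertices, and its independence number is half its order. $N[I]$ is the closed neighborhood of $I$. -}

module Defs where

open import Data.Nat using (ℕ; zero; suc; _*_; _≤_)
open import Data.Bool using (Bool; true; false; T; _∧_)
open import Data.Fin using (Fin; remQuot)
open import Data.Fin.Subset using (Subset; _∈_; _∉_; _∪_; ⁅_⁆; ∣_∣; ⊤)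
open import Data.Product using (_×_; _,_; proj₁; proj₂; Σ; ∃)
open import Data.Sum using (_⊎_)
open import Relation.Nullary using (¬_)
open import Relation.Binary.PropositionalEquality using (_≡_; refl; cong₂)

record Graph (n : ℕ) : Set where
  field
    adj     : Fin n → Fin n → Bool
    adj-sym : ∀ u v → adj u v ≡ adj v u
    adj-irr : ∀ v → adj v v ≡ false

open Graph public

Adj : ∀ {n} → Graph n → Fin n → Fin n → Set
Adj G u v = T (adj G u v)

Nontrivial : ∀ {n} → Graph n → Set
Nontrivial {n} _ = 2 ≤ n

data WalkIn {n} (G : Graph n) (S : Subset n) : Fin n → Fin n → Set where
  here : ∀ {v} → v ∈ S → WalkIn G S v v
  step : ∀ {u w v} → u ∈ S → Adj G u w → WalkIn G S w v → WalkIn G S u v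

Connected : ∀ {n} → Graph n → Set
Connected G = ∀ u v → WalkIn G ⊤ u v

-- Direct (tensor) product on Fin (m * n), vertex i ↔ remQuot n i.
private
  ∧-comm : ∀ a b → (a ∧ b) ≡ (b ∧ a)
  ∧-comm false false = refl
  ∧-comm false true  = refl
  ∧-comm true  false = refl
  ∧-comm true  true  = refl

  ∧-false : ∀ a b → a ≡ false → (a ∧ b) ≡ false
  ∧-false .false b refl = refl

fstV : ∀ {m} n → Fin (m * n) → Fin m
fstV {m} n i = proj₁ (remQuot {m} n i)

sndV : ∀ {m} n → Fin (m * n) → Fin n
sndV {m} n i = proj₂ (remQuot {m} n i)

_×G_ : ∀ {m n} → Graph m → Graph n → Graph (m * n)
_×G_ {m} {n} G H = record
  { adj     = λ i j → adj G (fstV {m} n i) (fstV {m} n j)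
                    ∧ adj H (sndV {m} n i) (sndV {m} n j)
  ; adj-sym = λ i j → cong₂ _∧_
      (adj-sym G (fstV {m} n i) (fstV {m} n j))
      (adj-sym H (sndV {m} n i) (sndV {m} n j))
  ; adj-irr = λ i → ∧-false _ _ (adj-irr G (fstV {m} n i))
  }

Independent : ∀ {n} → Graph n → Subset n → Set
Independent G S = ∀ u v → u ∈ S → v ∈ S → ¬ Adj G u v

MaximalIndependent : ∀ {n} → Graph n → Subset n → Set
MaximalIndependent G S =
  Independent G S × (∀ v → v ∉ S → ¬ Independent G (S ∪ ⁅ v ⁆))

WellCovered : ∀ {n} → Graph n → Set
WellCovered G = ∀ S T → MaximalIndependent G S → MaximalIndependent G T → ∣ S ∣ ≡ ∣ T ∣

IndependenceNumber : ∀ {n} → Graph n → ℕ → Set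
IndependenceNumber G k =
  Σ (Subset _) (λ S → Independent G S × ∣ S ∣ ≡ k) ×
  (∀ S → Independent G S → ∣ S ∣ ≤ k)

NoIsolated : ∀ {n} → Graph n → Set
NoIsolated G = ∀ v → ∃ λ u → Adj G v u

VeryWellCovered : ∀ {n} → Graph n → Set
VeryWellCovered {n} G =
  WellCovered G × NoIsolated G × (∀ k → IndependenceNumber G k → 2 * k ≡ n)

_∈N[_]_ : ∀ {n} → Fin n → Graph n → Subset n → Set
v ∈N[ G ] I = v ∈ I ⊎ ∃ λ u → u ∈ I × Adj G u v

IsComponentOfMinusN : ∀ {n} → (G : Graph n) → Subset n → Subset n → Set
IsComponentOfMinusN G I C =
  (∀ v → v ∈ C → ¬ (v ∈N[ G ] I)) ×
  (∃ λ v → v ∈ C) ×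
  (∀ u v → u ∈ C → v ∈ C → WalkIn G C u v) ×
  (∀ u v → u ∈ C → Adj G u v → ¬ (v ∈N[ G ] I) → v ∈ C)

BipartiteOn : ∀ {n} → Graph n → Subset n → Set
BipartiteOn {n} G C =
  Σ (Fin n → Bool) λ col →
    ∀ u v → u ∈ C → v ∈ C → Adj G u v → ¬ (col u ≡ col v)

module Submission where

-- Suppose B has an edge, so both colour classes X, Y of B are nonempty. Extend
-- I × V(H) to a maximal independent set S of G × H. Since B is a component of
-- G − N[I], the part of S outside B × V(H) is neither adjacent to B × V(H) nor
-- needs it for domination, so replacing S ∩ (B × V(H)) by X × V(H), Y × V(H) or
-- B × J (J maximal independent in H) gives three maximal independent sets. Their
-- sizes agree: |X|·|H| = |Y|·|H| = |B|·|J|, whence |H| = 2|J|. Then V(G) × J is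
-- maximal independent of size |G|·|H|/2, so G × H would be very well-covered.

open import Defs
open import Level using (0ℓ)
open import Data.Nat using (ℕ; zero; suc; _+_; _*_; _≤_; _<_; z≤n; s≤s; >-nonZero)
open import Data.Nat.Properties
  using (+-*-semiring; *-commutativeSemigroup; +-identityʳ; +-assoc; *-identityʳ; m≤m+n; m≤n+m; *-distribˡ-+; +-cancelʳ-≡; *-cancelˡ-≡; ≤-antisym; ≤-trans; ≤-reflexive)
open import Algebra.Properties.CommutativeSemigroup *-commutativeSemigroup using (x∙yz≈y∙xz)
open import Algebra.Properties.Semiring.Sum +-*-semiring using (sum; sum-syntax; ∑-distrib-+; *-distribʳ-sum; sum-cong-≗)
open import Data.Bool using (Bool; true; false; T; not; if_then_else_)
open import Data.Bool.Properties using (T-∧; not-injective; ¬-not)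
open import Data.Fin using (Fin; zero; suc; combine; _↑ˡ_; _↑ʳ_)
open import Data.Fin.Properties using (any?; remQuot-combine; combine-remQuot; _≟_)
open import Data.Fin.Subset using (Subset; _∈_; _∉_; _∪_; ⁅_⁆; ∣_∣; ⊥; _⊆_; _⊂_; _⊃_)
open import Data.Fin.Subset.Properties
  using (_∈?_; x∈⁅x⁆; x∈⁅y⁆⇒x≡y; p⊆p∪q; q⊆p∪q; x∈p∪q⁻; ∉⊥; ∣⁅x⁆∣≡1; p⊆q⇒∣p∣≤∣q∣; ⊆-antisym)
open import Data.Fin.Subset.Induction using (Acc; acc; ⊃-wellFounded)
open import Data.Vec using ([]; _∷_; lookup; tabulate)
open import Data.Vec.Properties using ([]=⇒lookup; lookup⇒[]=; lookup∘tabulate)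
open import Data.Product using (_×_; _,_; proj₁; proj₂; ∃; ∃₂)
open import Data.Sum using (_⊎_; inj₁; inj₂)
open import Data.Unit using (tt)
open import Function using (_∘_; Equivalence)
open import Relation.Nullary using (¬_; Dec; yes; no; does; contradiction)
open import Relation.Nullary.Decidable using (_×-dec_; _⊎-dec_; ¬?; T?; dec-true; decidable-stable)
open import Relation.Unary using (Pred; U)
open import Relation.Binary.PropositionalEquality
  using (_≡_; _≢_; refl; sym; trans; cong; cong₂; subst; module ≡-Reasoning)

toℕ : Bool → ℕ
toℕ false = 0
toℕ true  = 1

∈⇒lookup : ∀ {n} {S : Subset n} {i} → i ∈ S → lookup S i ≡ true
∈⇒lookup = []=⇒lookup

lookup⇒∈ : ∀ {n} {S : Subset n} {i} → lookup S i ≡ true → i ∈ S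
lookup⇒∈ {S = S} {i} = lookup⇒[]= i S

module _ {n} (G : Graph n) where

  Adj-sym : ∀ {u v} → Adj G u v → Adj G v u
  Adj-sym {u} {v} = subst T (adj-sym G u v)

  Adj-irrefl : ∀ {v} → ¬ Adj G v v
  Adj-irrefl {v} = subst T (adj-irr G v)

  Adj? : ∀ u v → Dec (Adj G u v)
  Adj? u v = T? (adj G u v)

  HasNeighbourIn : Subset n → Fin n → Set
  HasNeighbourIn S v = ∃ λ u → u ∈ S × Adj G v u

  hasNeighbourIn? : ∀ S v → Dec (HasNeighbourIn S v)
  hasNeighbourIn? S v = any? λ u → (u ∈? S) ×-dec Adj? v u

  Dominating : Subset n → Set
  Dominating S = ∀ v → v ∉ S → HasNeighbourIn S v

  NoIsolatedIn : Pred (Fin n) 0ℓ → Set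
  NoIsolatedIn R = ∀ {v} → R v → ∃ λ u → R u × Adj G v u

  noIsolated⇒noIsolatedIn-U : NoIsolated G → NoIsolatedIn U
  noIsolated⇒noIsolatedIn-U noIso {v} _ = proj₁ (noIso v) , tt , proj₂ (noIso v)

  ProperColouringOn : Subset n → (Fin n → Bool) → Set
  ProperColouringOn C col = ∀ u v → u ∈ C → v ∈ C → Adj G u v → col u ≢ col v

  properColouringOn-not : ∀ {C col} → ProperColouringOn C col → ProperColouringOn C (not ∘ col)
  properColouringOn-not proper u v u∈ v∈ uv = proper u v u∈ v∈ uv ∘ not-injective

  independent-∪⁅⁆ : ∀ {S v} → Independent G S → ¬ HasNeighbourIn S v →
                    Independent G (S ∪ ⁅ v ⁆)
  independent-∪⁅⁆ {S} {v} ind free a b a∈ b∈ with x∈p∪q⁻ S ⁅ v ⁆ a∈ | x∈p∪q⁻ S ⁅ v ⁆ b∈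
  ... | inj₁ a∈S | inj₁ b∈S = ind a b a∈S b∈S
  ... | inj₁ a∈S | inj₂ b∈v rewrite x∈⁅y⁆⇒x≡y v b∈v = λ av → free (a , a∈S , Adj-sym av)
  ... | inj₂ a∈v | inj₁ b∈S rewrite x∈⁅y⁆⇒x≡y v a∈v = λ vb → free (b , b∈S , vb)
  ... | inj₂ a∈v | inj₂ b∈v rewrite x∈⁅y⁆⇒x≡y v a∈v | x∈⁅y⁆⇒x≡y v b∈v = Adj-irrefl

  maximal⇒dominating : ∀ {S} → MaximalIndependent G S → Dominating S
  maximal⇒dominating {S} (ind , maximal) v v∉S =
    decidable-stable (hasNeighbourIn? S v) (maximal v v∉S ∘ independent-∪⁅⁆ ind)

  dominating⇒maximal : ∀ {S} → Independent G S → Dominating S → MaximalIndependent G S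
  dominating⇒maximal {S} ind dom = ind , λ v v∉S ind′ →
    let (u , u∈S , vu) = dom v v∉S
    in ind′ v u (q⊆p∪q S ⁅ v ⁆ (x∈⁅x⁆ v)) (p⊆p∪q ⁅ v ⁆ u∈S) vu

  extendToMaximal : ∀ {S} → Independent G S → ∃ λ S′ → S ⊆ S′ × MaximalIndependent G S′
  extendToMaximal {S} = go (⊃-wellFounded S)
    where
    go : ∀ {S} → Acc _⊃_ S → Independent G S → ∃ λ S′ → S ⊆ S′ × MaximalIndependent G S′
    go {S} (acc rec) ind with any? (λ v → ¬? (v ∈? S) ×-dec ¬? (hasNeighbourIn? S v))
    ... | yes (v , v∉S , free) =
      let S⊂S∪v : S ⊂ S ∪ ⁅ v ⁆
          S⊂S∪v = p⊆p∪q ⁅ v ⁆ , v , q⊆p∪q S ⁅ v ⁆ (x∈⁅x⁆ v) , v∉S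
          (S′ , ⊆S′ , maxS′) = go (rec S⊂S∪v) (independent-∪⁅⁆ ind free)
      in S′ , ⊆S′ ∘ p⊆p∪q ⁅ v ⁆ , maxS′
    ... | no noneFree = S , (λ x∈ → x∈) , dominating⇒maximal ind λ v v∉S →
      decidable-stable (hasNeighbourIn? S v) (λ free → noneFree (v , v∉S , free))

  maximalIndependent-exists : ∃ (MaximalIndependent G)
  maximalIndependent-exists =
    let (S , _ , maxS) = extendToMaximal {⊥} λ u _ u∈⊥ → contradiction u∈⊥ ∉⊥ in S , maxS

  wellCovered⇒independenceNumber≡ : ∀ {A k} → WellCovered G → MaximalIndependent G A →
                                   IndependenceNumber G k → k ≡ ∣ A ∣
  wellCovered⇒independenceNumber≡ {A} wc maxA ((S , indS , ∣S∣≡k) , ≤k) =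
    let (S′ , S⊆S′ , maxS′) = extendToMaximal indS
    in ≤-antisym (subst (_≤ ∣ A ∣) ∣S∣≡k (≤-trans (p⊆q⇒∣p∣≤∣q∣ S⊆S′) (≤-reflexive (wc S′ A maxS′ maxA))))
                 (≤k A (proj₁ maxA))

  walk-head : ∀ {S u v} → WalkIn G S u v → u ∈ S
  walk-head (here u∈S)     = u∈S
  walk-head (step u∈S _ _) = u∈S

  walk⇒hasNeighbourIn : ∀ {S u v} → WalkIn G S u v → u ≢ v → HasNeighbourIn S u
  walk⇒hasNeighbourIn (here _)        u≢u = contradiction refl u≢u
  walk⇒hasNeighbourIn (step _ uw wv) _   = _ , walk-head wv , uw

  connected⇒noIsolated : Nontrivial G → Connected G → NoIsolated G
  connected⇒noIsolated (s≤s (s≤s z≤n)) conn zero =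
    let (u , _ , a) = walk⇒hasNeighbourIn (conn zero (suc zero)) (λ ()) in u , a
  connected⇒noIsolated (s≤s (s≤s z≤n)) conn (suc v) =
    let (u , _ , a) = walk⇒hasNeighbourIn (conn (suc v) zero) (λ ()) in u , a

  connectedIn⇒∣∣≡1⊎noIsolatedIn : ∀ {B} → (∃ λ b → b ∈ B) →
    (∀ u v → u ∈ B → v ∈ B → WalkIn G B u v) → ∣ B ∣ ≡ 1 ⊎ NoIsolatedIn (_∈ B)
  connectedIn⇒∣∣≡1⊎noIsolatedIn {B} (b₀ , b₀∈B) walk
    with any? (λ b → (b ∈? B) ×-dec ¬? (b ≟ b₀))
  ... | yes (b₁ , b₁∈B , b₁≢b₀) = inj₂ neighbour
    where
    neighbour : NoIsolatedIn (_∈ B)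
    neighbour {b} b∈B with b ≟ b₀
    ... | yes refl = walk⇒hasNeighbourIn (walk b b₁ b∈B b₁∈B) (b₁≢b₀ ∘ sym)
    ... | no  b≢b₀ = walk⇒hasNeighbourIn (walk b b₀ b∈B b₀∈B) b≢b₀
  ... | no onlyB₀ = inj₁ (trans (cong ∣_∣ B≡⁅b₀⁆) (∣⁅x⁆∣≡1 b₀))
    where
    ≡b₀ : ∀ {b} → b ∈ B → b ≡ b₀
    ≡b₀ {b} b∈B = decidable-stable (b ≟ b₀) (λ b≢b₀ → onlyB₀ (b , b∈B , b≢b₀))
    B≡⁅b₀⁆ : B ≡ ⁅ b₀ ⁆
    B≡⁅b₀⁆ = ⊆-antisym (λ b∈B → subst (_∈ ⁅ b₀ ⁆) (sym (≡b₀ b∈B)) (x∈⁅x⁆ b₀))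
                       (λ b∈b₀ → subst (_∈ B) (sym (x∈⁅y⁆⇒x≡y b₀ b∈b₀)) b₀∈B)

∑-const : ∀ n c → ∑[ i < n ] c ≡ n * c
∑-const zero    c = refl
∑-const (suc n) c = cong (c +_) (∑-const n c)

∣∣≡∑ : ∀ {n} (S : Subset n) → ∣ S ∣ ≡ ∑[ i < n ] toℕ (lookup S i)
∣∣≡∑ []          = refl
∣∣≡∑ (true  ∷ S) = cong suc (∣∣≡∑ S)
∣∣≡∑ (false ∷ S) = ∣∣≡∑ S

∑-↑ : ∀ a b (f : Fin (a + b) → ℕ) → sum f ≡ ∑[ i < a ] f (i ↑ˡ b) + ∑[ j < b ] f (a ↑ʳ j)
∑-↑ zero    b f = refl
∑-↑ (suc a) b f = trans (cong (f zero +_) (∑-↑ a b (f ∘ suc))) (sym (+-assoc (f zero) _ _))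

∑-combine : ∀ m n (f : Fin (m * n) → ℕ) → sum f ≡ ∑[ g < m ] ∑[ h < n ] f (combine g h)
∑-combine zero    n f = refl
∑-combine (suc m) n f =
  trans (∑-↑ n (m * n) f) (cong (∑[ h < n ] f (h ↑ˡ m * n) +_) (∑-combine m n (f ∘ (n ↑ʳ_))))

≤-∑ : ∀ {n} (f : Fin n → ℕ) i → f i ≤ sum f
≤-∑ f zero    = m≤m+n (f zero) _
≤-∑ f (suc i) = ≤-trans (≤-∑ (f ∘ suc) i) (m≤n+m _ (f zero))

module Product {m n} (G : Graph m) (H : Graph n) where

  πG : Fin (m * n) → Fin m
  πG = fstV {m} n

  πH : Fin (m * n) → Fin n
  πH = sndV {m} n

  πG-combine : ∀ g h → πG (combine g h) ≡ g
  πG-combine g h = cong proj₁ (remQuot-combine {m} {n} g h)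

  πH-combine : ∀ g h → πH (combine g h) ≡ h
  πH-combine g h = cong proj₂ (remQuot-combine {m} {n} g h)

  Adj-×⁻ : ∀ {w w′} → Adj (G ×G H) w w′ → Adj G (πG w) (πG w′) × Adj H (πH w) (πH w′)
  Adj-×⁻ = Equivalence.to T-∧

  Adj-×⁺ : ∀ {w g′ h′} → Adj G (πG w) g′ → Adj H (πH w) h′ → Adj (G ×G H) w (combine g′ h′)
  Adj-×⁺ {w} {g′} {h′} gg′ hh′ = Equivalence.from T-∧
    ( subst (Adj G (πG w)) (sym (πG-combine g′ h′)) gg′
    , subst (Adj H (πH w)) (sym (πH-combine g′ h′)) hh′ )

  Adj-×⁺-combine : ∀ {g g′ h h′} → Adj G g g′ → Adj H h h′ →
                   Adj (G ×G H) (combine g h) (combine g′ h′)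
  Adj-×⁺-combine {g} {g′} {h} {h′} gg′ hh′ = Adj-×⁺
    (subst (λ x → Adj G x g′) (sym (πG-combine g h)) gg′)
    (subst (λ y → Adj H y h′) (sym (πH-combine g h)) hh′)

  noIsolated-× : NoIsolated G → NoIsolated H → NoIsolated (G ×G H)
  noIsolated-× noIsoG noIsoH w = _ , Adj-×⁺ (proj₂ (noIsoG (πG w))) (proj₂ (noIsoH (πH w)))

  Pattern : Set
  Pattern = Fin m → Fin n → Bool

  IndependentOn : Pred (Fin m) 0ℓ → Pattern → Set
  IndependentOn R F = ∀ {g g′ h h′} → R g → R g′ → F g h ≡ true → F g′ h′ ≡ true →
                      Adj G g g′ → ¬ Adj H h h′

  DominatingOn : Pred (Fin m) 0ℓ → Pattern → Set
  DominatingOn R F = ∀ {g h} → R g → F g h ≡ false →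
                     ∃₂ λ g′ h′ → R g′ × F g′ h′ ≡ true × Adj G g g′ × Adj H h h′

  toSubset : Pattern → Subset (m * n)
  toSubset F = tabulate λ w → F (πG w) (πH w)

  patternOf : Subset (m * n) → Pattern
  patternOf S g h = lookup S (combine g h)

  ∈toSubset⁺ : ∀ {F w} → F (πG w) (πH w) ≡ true → w ∈ toSubset F
  ∈toSubset⁺ {w = w} e = lookup⇒∈ (trans (lookup∘tabulate _ w) e)

  ∈toSubset⁻ : ∀ {F w} → w ∈ toSubset F → F (πG w) (πH w) ≡ true
  ∈toSubset⁻ {w = w} w∈ = trans (sym (lookup∘tabulate _ w)) (∈⇒lookup w∈)

  combine-∈toSubset : ∀ {F g h} → F g h ≡ true → combine g h ∈ toSubset F
  combine-∈toSubset {F} {g} {h} e = ∈toSubset⁺ {F} (trans (cong₂ F (πG-combine g h) (πH-combine g h)) e)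

  toSubset-independent : ∀ {F} → IndependentOn U F → Independent (G ×G H) (toSubset F)
  toSubset-independent {F} indF w w′ w∈ w′∈ ww′ =
    indF tt tt (∈toSubset⁻ {F} w∈) (∈toSubset⁻ {F} w′∈) (proj₁ (Adj-×⁻ ww′)) (proj₂ (Adj-×⁻ ww′))

  toSubset-maximal : ∀ {F} → IndependentOn U F → DominatingOn U F →
                     MaximalIndependent (G ×G H) (toSubset F)
  toSubset-maximal {F} indF domF = dominating⇒maximal (G ×G H) (toSubset-independent indF) dominating
    where
    dominating : Dominating (G ×G H) (toSubset F)
    dominating w w∉ =
      let (g′ , h′ , _ , e′ , gg′ , hh′) = domF tt (¬-not (w∉ ∘ ∈toSubset⁺ {F}))
      in combine g′ h′ , combine-∈toSubset {F} e′ , Adj-×⁺ gg′ hh′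

  independent⇒independentOn : ∀ {S} → Independent (G ×G H) S → IndependentOn U (patternOf S)
  independent⇒independentOn indS _ _ e e′ gg′ hh′ =
    indS _ _ (lookup⇒∈ e) (lookup⇒∈ e′) (Adj-×⁺-combine gg′ hh′)

  maximal⇒dominatingOn : ∀ {S} → MaximalIndependent (G ×G H) S → DominatingOn U (patternOf S)
  maximal⇒dominatingOn {S} maxS {g} {h} _ e =
    let (w , w∈S , ghw) = maximal⇒dominating (G ×G H) maxS (combine g h)
                            (λ gh∈S → contradiction (trans (sym e) (∈⇒lookup gh∈S)) λ ())
        (gw , hw) = Adj-×⁻ ghw
    in πG w , πH w , tt
     , trans (cong (lookup S) (combine-remQuot {m} n w)) (∈⇒lookup w∈S)
     , subst (λ x → Adj G x (πG w)) (πG-combine g h) gw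
     , subst (λ y → Adj H y (πH w)) (πH-combine g h) hw

  row : Pattern → Fin m → ℕ
  row F g = ∑[ h < n ] toℕ (F g h)

  ∣toSubset∣ : ∀ F → ∣ toSubset F ∣ ≡ ∑[ g < m ] row F g
  ∣toSubset∣ F = trans (∣∣≡∑ (toSubset F)) (trans (∑-combine m n _)
    (sum-cong-≗ λ g → sum-cong-≗ λ h → cong toℕ
      (trans (lookup∘tabulate _ (combine g h)) (cong₂ F (πG-combine g h) (πH-combine g h)))))

  module _ (B : Subset m) where

    splice : Pattern → Pattern → Pattern
    splice T S g h = if does (g ∈? B) then T g h else S g h

    Separated : Pattern → Set
    Separated S = ∀ {b g h} → b ∈ B → g ∉ B → S g h ≡ true → ¬ Adj G b g

    splice-inside : ∀ {T S g h} → g ∈ B → T g h ≡ true → splice T S g h ≡ true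
    splice-inside {g = g} g∈B e with g ∈? B
    ... | yes _   = e
    ... | no g∉B = contradiction g∈B g∉B

    splice-outside : ∀ {T S g h} → g ∉ B → S g h ≡ true → splice T S g h ≡ true
    splice-outside {g = g} g∉B e with g ∈? B
    ... | yes g∈B = contradiction g∈B g∉B
    ... | no _    = e

    splice-independent : ∀ {T S} → IndependentOn (_∈ B) T → IndependentOn (_∉ B) S →
                         Separated S → IndependentOn U (splice T S)
    splice-independent indT indS sep {g} {g′} _ _ with g ∈? B | g′ ∈? B
    ... | yes g∈B | yes g′∈B = indT g∈B g′∈B
    ... | yes g∈B | no g′∉B  = λ _ e′ gg′ _ → sep g∈B g′∉B e′ gg′
    ... | no g∉B  | yes g′∈B = λ e _ gg′ _ → sep g′∈B g∉B e (Adj-sym G gg′)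
    ... | no g∉B  | no g′∉B  = indS g∉B g′∉B

    splice-dominating : ∀ {T S} → DominatingOn (_∈ B) T → DominatingOn (_∉ B) S →
                        DominatingOn U (splice T S)
    splice-dominating {T} {S} domT domS {g} _ with g ∈? B
    ... | yes g∈B = λ e →
      let (g′ , h′ , g′∈B , e′ , gg′ , hh′) = domT g∈B e
      in g′ , h′ , tt , splice-inside {T} {S} g′∈B e′ , gg′ , hh′
    ... | no g∉B = λ e →
      let (g′ , h′ , g′∉B , e′ , gg′ , hh′) = domS g∉B e
      in g′ , h′ , tt , splice-outside {T} {S} g′∉B e′ , gg′ , hh′

    χ : Fin m → ℕ
    χ g = toℕ (does (g ∈? B))

    inside : Pattern → ℕ
    inside T = ∑[ g < m ] (χ g * row T g)

    outside : Pattern → ℕ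
    outside S = ∑[ g < m ] (toℕ (not (does (g ∈? B))) * row S g)

    ∣splice∣ : ∀ T S → ∣ toSubset (splice T S) ∣ ≡ inside T + outside S
    ∣splice∣ T S = trans (∣toSubset∣ (splice T S)) (trans (sum-cong-≗ row-splice) (∑-distrib-+ (λ g → χ g * row T g) _))
      where
      row-splice : ∀ g → row (splice T S) g ≡
                         χ g * row T g + toℕ (not (does (g ∈? B))) * row S g
      row-splice g with g ∈? B
      ... | yes _ = sym (trans (+-identityʳ _) (+-identityʳ _))
      ... | no _  = sym (+-identityʳ _)

    inside-+ : ∀ T T′ → inside T + inside T′ ≡ ∑[ g < m ] (χ g * (row T g + row T′ g))
    inside-+ T T′ = sym (trans (sum-cong-≗ λ g → *-distribˡ-+ (χ g) (row T g) (row T′ g))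
                                (∑-distrib-+ (λ g → χ g * row T g) (λ g → χ g * row T′ g)))

    ∑χ*-constant : ∀ {f : Fin m → ℕ} {c} → (∀ g → f g ≡ c) → ∑[ g < m ] (χ g * f g) ≡ sum χ * c
    ∑χ*-constant {f} {c} f≡c =
      trans (sum-cong-≗ λ g → cong (χ g *_) (f≡c g)) (sym (*-distribʳ-sum c χ))

  colourClass : (Fin m → Bool) → Pattern
  colourClass col g h = col g

  layer : Subset n → Pattern
  layer J g h = lookup J h

  colourClass-independentOn : ∀ {C col} → ProperColouringOn G C col →
                              IndependentOn (_∈ C) (colourClass col)
  colourClass-independentOn proper {g} {g′} g∈ g′∈ e e′ gg′ _ =
    proper g g′ g∈ g′∈ gg′ (trans e (sym e′))

  colourClass-dominatingOn : ∀ {C col} → ProperColouringOn G C col → NoIsolatedIn G (_∈ C) →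
                             NoIsolated H → DominatingOn (_∈ C) (colourClass col)
  colourClass-dominatingOn {col = col} proper noIsoC noIsoH {g} {h} g∈ e =
    let (g′ , g′∈ , gg′) = noIsoC g∈
        (h′ , hh′) = noIsoH h
    in g′ , h′ , g′∈ , ¬-not (λ e′ → proper g g′ g∈ g′∈ gg′ (trans e (sym e′))) , gg′ , hh′

  row-colourClass-+ : ∀ col g → row (colourClass col) g + row (colourClass (not ∘ col)) g ≡ n
  row-colourClass-+ col g = trans (sym (∑-distrib-+ {n} (λ _ → toℕ (col g)) (λ _ → toℕ (not (col g)))))
    (trans (sum-cong-≗ {n} λ _ → toℕ+toℕ∘not (col g)) (trans (∑-const n 1) (*-identityʳ n)))
    where
    toℕ+toℕ∘not : ∀ b → toℕ b + toℕ (not b) ≡ 1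
    toℕ+toℕ∘not true  = refl
    toℕ+toℕ∘not false = refl

  layer-independentOn : ∀ {R J} → Independent H J → IndependentOn R (layer J)
  layer-independentOn indJ _ _ e e′ _ = indJ _ _ (lookup⇒∈ e) (lookup⇒∈ e′)

  layer-dominatingOn : ∀ {R J} → MaximalIndependent H J → NoIsolatedIn G R → DominatingOn R (layer J)
  layer-dominatingOn {J = J} maxJ noIsoR {g} {h} r e =
    let (g′ , r′ , gg′) = noIsoR r
        (h′ , h′∈J , hh′) = maximal⇒dominating H maxJ h
                              (λ h∈J → contradiction (trans (sym e) (∈⇒lookup h∈J)) λ ())
    in g′ , h′ , r′ , ∈⇒lookup h′∈J , gg′ , hh′

  row-layer : ∀ J g → row (layer J) g ≡ ∣ J ∣
  row-layer J g = sym (∣∣≡∑ J)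

∈N[]? : ∀ {n} (G : Graph n) I v → Dec (v ∈N[ G ] I)
∈N[]? G I v = (v ∈? I) ⊎-dec any? (λ u → (u ∈? I) ×-dec Adj? G u v)

module Component {m n} (G : Graph m) (H : Graph n) (noIsoH : NoIsolated H)
                 {I B : Subset m} (comp : IsComponentOfMinusN G I B) where

  open Product G H

  private
    disjoint = proj₁ comp
    closed   = proj₂ (proj₂ (proj₂ comp))

  outside-neighbour⇒∈N[] : ∀ {b g} → b ∈ B → Adj G b g → g ∉ B → g ∈N[ G ] I
  outside-neighbour⇒∈N[] {b} {g} b∈B bg g∉B =
    decidable-stable (∈N[]? G I g) (λ g∉N → g∉B (closed b g b∈B bg g∉N))

  module _ {S : Pattern} (indS : IndependentOn U S) (domS : DominatingOn U S)
           (I×V⊆S : ∀ {g h} → g ∈ I → S g h ≡ true) where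

    separated : Separated B S
    separated {b} {g} {h} b∈B g∉B e bg with outside-neighbour⇒∈N[] b∈B bg g∉B
    ... | inj₁ g∈I = disjoint b b∈B (inj₂ (g , g∈I , Adj-sym G bg))
    ... | inj₂ (u , u∈I , ug) =
      let (h′ , hh′) = noIsoH h in indS tt tt (I×V⊆S u∈I) e ug (Adj-sym H hh′)

    outside-dominating : DominatingOn (_∉ B) S
    outside-dominating {g} {h} g∉B e with ∈N[]? G I g
    ... | yes (inj₁ g∈I) = contradiction (trans (sym e) (I×V⊆S g∈I)) λ ()
    ... | yes (inj₂ (u , u∈I , ug)) =
      let (h′ , hh′) = noIsoH h
      in u , h′ , (λ u∈B → disjoint u u∈B (inj₁ u∈I)) , I×V⊆S u∈I , Adj-sym G ug , hh′
    ... | no g∉N =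
      let (g′ , h′ , _ , e′ , gg′ , hh′) = domS tt e
      in g′ , h′ , (λ g′∈B → g∉N (outside-neighbour⇒∈N[] g′∈B (Adj-sym G gg′) g∉B))
       , e′ , gg′ , hh′

module BipartiteComponent {m n} (G : Graph m) (H : Graph n)
  (noIsoG : NoIsolated G) (noIsoH : NoIsolated H) (wc : WellCovered (G ×G H))
  {I B : Subset m} (indI : Independent G I) (comp : IsComponentOfMinusN G I B)
  {col : Fin m → Bool} (proper : ProperColouringOn G B col) (noIsoB : NoIsolatedIn G (_∈ B))
  where

  open Product G H
  open Component G H noIsoH comp

  J : Subset n
  J = proj₁ (maximalIndependent-exists H)

  maxJ : MaximalIndependent H J
  maxJ = proj₂ (maximalIndependent-exists H)

  rowsOfI : Pattern
  rowsOfI g h = lookup I g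

  I×V-independent : Independent (G ×G H) (toSubset rowsOfI)
  I×V-independent = toSubset-independent λ _ _ e e′ gg′ _ → indI _ _ (lookup⇒∈ e) (lookup⇒∈ e′) gg′

  S : Subset (m * n)
  S = proj₁ (extendToMaximal (G ×G H) I×V-independent)

  maxS : MaximalIndependent (G ×G H) S
  maxS = proj₂ (proj₂ (extendToMaximal (G ×G H) I×V-independent))

  s : Pattern
  s = patternOf S

  I×V⊆s : ∀ {g h} → g ∈ I → s g h ≡ true
  I×V⊆s g∈I = ∈⇒lookup (proj₁ (proj₂ (extendToMaximal (G ×G H) I×V-independent))
                         (combine-∈toSubset {rowsOfI} (∈⇒lookup g∈I)))

  spliced-maximal : ∀ {T} → IndependentOn (_∈ B) T → DominatingOn (_∈ B) T →
                    MaximalIndependent (G ×G H) (toSubset (splice B T s))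
  spliced-maximal indT domT = toSubset-maximal
    (splice-independent B indT (λ _ _ → inds tt tt) (separated inds doms I×V⊆s))
    (splice-dominating B domT (outside-dominating inds doms I×V⊆s))
    where
    inds = independent⇒independentOn (proj₁ maxS)
    doms = maximal⇒dominatingOn maxS

  inside-≡ : ∀ {T T′} → IndependentOn (_∈ B) T → DominatingOn (_∈ B) T →
             IndependentOn (_∈ B) T′ → DominatingOn (_∈ B) T′ → inside B T ≡ inside B T′
  inside-≡ {T} {T′} indT domT indT′ domT′ = +-cancelʳ-≡ (outside B s) _ _ (begin
    inside B T + outside B s       ≡⟨ sym (∣splice∣ B T s) ⟩
    ∣ toSubset (splice B T s) ∣    ≡⟨ wc _ _ (spliced-maximal indT domT) (spliced-maximal indT′ domT′) ⟩
    ∣ toSubset (splice B T′ s) ∣   ≡⟨ ∣splice∣ B T′ s ⟩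
    inside B T′ + outside B s      ∎)
    where open ≡-Reasoning

  X Y L : Pattern
  X = colourClass col
  Y = colourClass (not ∘ col)
  L = layer J

  inside-X≡L : inside B X ≡ inside B L
  inside-X≡L = inside-≡
    (colourClass-independentOn proper) (colourClass-dominatingOn proper noIsoB noIsoH)
    (layer-independentOn (proj₁ maxJ)) (layer-dominatingOn maxJ noIsoB)

  inside-Y≡L : inside B Y ≡ inside B L
  inside-Y≡L = inside-≡
    (colourClass-independentOn proper′) (colourClass-dominatingOn proper′ noIsoB noIsoH)
    (layer-independentOn (proj₁ maxJ)) (layer-dominatingOn maxJ noIsoB)
    where proper′ = properColouringOn-not G proper

  ∑χ>0 : 0 < sum (χ B)
  ∑χ>0 = let (b₀ , b₀∈B) = proj₁ (proj₂ comp) in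
    subst (_≤ sum (χ B)) (cong toℕ (dec-true (b₀ ∈? B) b₀∈B)) (≤-∑ (χ B) b₀)

  n≡2∣J∣ : n ≡ 2 * ∣ J ∣
  n≡2∣J∣ = *-cancelˡ-≡ n (2 * ∣ J ∣) β {{>-nonZero ∑χ>0}} (begin
    β * n                                      ≡⟨ sym (∑χ*-constant B (row-colourClass-+ col)) ⟩
    ∑[ g < m ] (χ B g * (row X g + row Y g))   ≡⟨ sym (inside-+ B X Y) ⟩
    inside B X + inside B Y                    ≡⟨ cong₂ _+_ inside-X≡L inside-Y≡L ⟩
    inside B L + inside B L                    ≡⟨ cong (λ k → k + k) (∑χ*-constant B (row-layer J)) ⟩
    β * ∣ J ∣ + β * ∣ J ∣                      ≡⟨ sym (*-distribˡ-+ β ∣ J ∣ ∣ J ∣) ⟩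
    β * (∣ J ∣ + ∣ J ∣)                        ≡⟨ cong (λ k → β * (∣ J ∣ + k)) (sym (+-identityʳ ∣ J ∣)) ⟩
    β * (2 * ∣ J ∣)                            ∎)
    where
    open ≡-Reasoning
    β = sum (χ B)

  ∣V×J∣ : ∣ toSubset L ∣ ≡ m * ∣ J ∣
  ∣V×J∣ = trans (∣toSubset∣ L) (trans (sum-cong-≗ (row-layer J)) (∑-const m ∣ J ∣))

  V×J-maximal : MaximalIndependent (G ×G H) (toSubset L)
  V×J-maximal = toSubset-maximal (layer-independentOn (proj₁ maxJ))
                                 (layer-dominatingOn maxJ (noIsolated⇒noIsolatedIn-U G noIsoG))

  veryWellCovered : VeryWellCovered (G ×G H)
  veryWellCovered = wc , noIsolated-× noIsoG noIsoH , λ k α → begin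
    2 * k            ≡⟨ cong (2 *_) (trans (wellCovered⇒independenceNumber≡ (G ×G H) wc V×J-maximal α) ∣V×J∣) ⟩
    2 * (m * ∣ J ∣)  ≡⟨ x∙yz≈y∙xz 2 m ∣ J ∣ ⟩
    m * (2 * ∣ J ∣)  ≡⟨ cong (m *_) (sym n≡2∣J∣) ⟩
    m * n            ∎
    where open ≡-Reasoning

lemma5p1 : ∀ {m n} (G : Graph m) (H : Graph n) →
    Nontrivial G → Nontrivial H → Connected G → Connected H →
    WellCovered (G ×G H) → ¬ VeryWellCovered (G ×G H) →
    (I B : Subset m) → Independent G I →
    IsComponentOfMinusN G I B → BipartiteOn G B →
    ∣ B ∣ ≡ 1
lemma5p1 G H ntG ntH connG connH wc ¬vwc I B indI comp (col , proper)
  with connectedIn⇒∣∣≡1⊎noIsolatedIn G (proj₁ (proj₂ comp)) (proj₁ (proj₂ (proj₂ comp)))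
... | inj₁ ∣B∣≡1 = ∣B∣≡1
... | inj₂ noIsoB = contradiction
  (BipartiteComponent.veryWellCovered G H
    (connected⇒noIsolated G ntG connG) (connected⇒noIsolated H ntH connH) wc indI comp proper noIsoB)
  ¬vwc
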